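{- Let $\alpha \ge 2$ be a rational integer, and for $n \ge 0$ let $U_n(\alpha,1) = \frac{\alpha^n - 1}{\alpha - 1}$. Then there exist infinitely many positive integers $k$ such that \[k\left(U_n(\alpha,1) + (\alpha-1)^2\right) + 1\] is composite for all integers $n \ge 1$.
   Context: For a Lucas pair $(\alpha,\beta)$, the Lucas sequence of the first kind is $U_n(\alpha,\beta) = \frac{\alpha^n-\beta^n}{\alpha-\beta}$ for $n\ge 0$. With $\beta = 1$ and $\alpha\ge 2$ an integer, $U_n(\alpha,1) = 1 + \alpha + \cdots + \alpha^{n-1}$. -}

module Defs where

open import Data.Nat using (ℕ; zero; suc; _+_; _*_; _^_)

-- Lucas sequence of the first kind with β = 1:
-- U n α = 1 + α + ⋯ + α^(n-1)  ( = (α^n - 1)/(α - 1) for α ≥ 2 ).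
U : ℕ → ℕ → ℕ
U zero    α = 0
U (suc n) α = α ^ n + U n α

-- For an odd divisor q = 3 + 2h of α we have U n α ≡ 1 and (α − 1)² ≡ 1 (mod q) when n ≥ 1,
-- so every k ≡ h + 1 (mod q) makes q a proper divisor of k (U n α + (α − 1)²) + 1.
--
-- Otherwise α = 2 · 4^t or α = 4 · 4^t, and a Sierpiński-type covering argument works
-- uniformly in t. Take a covering system of congruences n ≡ r (mod d) with d ∣ 24 and attach
-- to each the value Φ_d(α) of the d-th cyclotomic polynomial. It divides U d α, so
-- U n α ≡ U r α (mod Φ_d(α)) whenever n ≡ r (mod d); and U r α + (α − 1)² is invertible
-- modulo Φ_d(α), so one residue class of k makes Φ_d(α) divide k (U n α + (α − 1)²) + 1 for
-- all such n. The values Φ_d(α) are pairwise coprime, so the Chinese remainder theorem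
-- combines these classes. Both the inverses and the coprimality come from polynomial
-- identities that hold up to a small constant D and are checked by reduction modulo Φ_d;
-- the primes dividing D are shown not to divide Φ_d(α) by computing α = B · 4^t modulo them.
module Submission where

open import Defs using (U)

module Polynomials where

  open import Data.Integer.Base using (ℤ; +_; -[1+_]; 0ℤ; 1ℤ; ∣_∣; _≤_; _+_; _-_; _*_; _^_)
  open import Data.Integer.Divisibility.Signed
    using (_∣_; divides; ∣-refl; ∣m∣n⇒∣m+n; ∣m∣n⇒∣m-n; ∣n⇒∣m*n)
  open import Data.Integer.Properties
    using (+-inverseʳ; +-identityˡ; +-identityʳ; *-zeroʳ; pos-+; pos-*; 0≤i⇒+∣i∣≡i)
  open import Data.Integer.Tactic.RingSolver using (solve-∀)
  open import Data.List.Base using (List; []; _∷_; _++_; map)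
  open import Data.List.Relation.Unary.All using (All; []; _∷_)
  open import Data.Nat.Base as ℕ using (ℕ; zero; suc)
  import Data.Nat.Properties as ℕ
  open import Data.Product.Base using (_×_; _,_; proj₁; proj₂)
  open import Data.Vec.Base as Vec using (Vec; []; _∷_; toList; zipWith)
  open import Function.Strict using (force; force-≡)
  open import Relation.Nullary.Negation using (¬_)
  open import Relation.Binary.PropositionalEquality
    using (_≡_; refl; sym; trans; cong; cong₂; subst; subst₂; module ≡-Reasoning)

  Poly : Set
  Poly = List ℤ

  eval : Poly → ℤ → ℤ
  eval []      x = 0ℤ
  eval (c ∷ p) x = c + x * eval p x

  infixl 6 _⊕_
  infixl 7 _·_ _⊗_

  _⊕_ : Poly → Poly → Poly
  []      ⊕ q       = q
  (a ∷ p) ⊕ []      = a ∷ p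
  (a ∷ p) ⊕ (b ∷ q) = a + b ∷ p ⊕ q

  _·_ : ℤ → Poly → Poly
  a · []      = []
  a · (b ∷ p) = a * b ∷ a · p

  _⊗_ : Poly → Poly → Poly
  []      ⊗ q = []
  (a ∷ p) ⊗ q = a · q ⊕ (0ℤ ∷ p ⊗ q)

  eval-⊕ : ∀ p q x → eval (p ⊕ q) x ≡ eval p x + eval q x
  eval-⊕ []      q       x = sym (+-identityˡ (eval q x))
  eval-⊕ (a ∷ p) []      x = sym (+-identityʳ _)
  eval-⊕ (a ∷ p) (b ∷ q) x rewrite eval-⊕ p q x = lemma a b x (eval p x) (eval q x)
    where lemma : ∀ a b x u v → a + b + x * (u + v) ≡ a + x * u + (b + x * v)
          lemma = solve-∀

  eval-· : ∀ a p x → eval (a · p) x ≡ a * eval p x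
  eval-· a []      x = sym (*-zeroʳ a)
  eval-· a (b ∷ p) x rewrite eval-· a p x = lemma a b x (eval p x)
    where lemma : ∀ a b x u → a * b + x * (a * u) ≡ a * (b + x * u)
          lemma = solve-∀

  eval-⊗ : ∀ p q x → eval (p ⊗ q) x ≡ eval p x * eval q x
  eval-⊗ []      q x = refl
  eval-⊗ (a ∷ p) q x
    rewrite eval-⊕ (a · q) (0ℤ ∷ p ⊗ q) x | eval-· a q x | eval-⊗ p q x
    = lemma a x (eval p x) (eval q x)
    where lemma : ∀ a x u v → a * v + (0ℤ + x * (u * v)) ≡ (a + x * u) * v
          lemma = solve-∀

  translate : ℤ → Poly → Poly
  translate a []      = []
  translate a (c ∷ p) = (c ∷ []) ⊕ (a ∷ 1ℤ ∷ []) ⊗ translate a p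

  eval-translate : ∀ a p x → eval (translate a p) x ≡ eval p (x + a)
  eval-translate a []      x = refl
  eval-translate a (c ∷ p) x
    rewrite eval-⊕ (c ∷ []) ((a ∷ 1ℤ ∷ []) ⊗ translate a p) x
          | eval-⊗ (a ∷ 1ℤ ∷ []) (translate a p) x | eval-translate a p x
    = lemma c a x (eval p (x + a))
    where lemma : ∀ c a x u → c + x * 0ℤ + (a + x * (1ℤ + x * 0ℤ)) * u ≡ c + (x + a) * u
          lemma = solve-∀

  eval-cong : ∀ {m} p {x y} → m ∣ x - y → m ∣ eval p x - eval p y
  eval-cong []      {x} {y} m∣x-y = divides 0ℤ refl
  eval-cong (c ∷ p) {x} {y} m∣x-y =
    subst (_ ∣_) (lemma c x y (eval p x) (eval p y))
      (∣m∣n⇒∣m+n (∣n⇒∣m*n x (eval-cong p m∣x-y)) (∣n⇒∣m*n (eval p y) m∣x-y))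
    where lemma : ∀ c x y u v → x * (u - v) + v * (x - y) ≡ c + x * u - (c + y * v)
          lemma = solve-∀

  ∤-cong : ∀ {m x y} p → m ∣ x - y → ¬ m ∣ eval p y → ¬ m ∣ eval p x
  ∤-cong {m} {x} {y} p m∣x-y m∤p[y] m∣p[x] =
    m∤p[y] (subst (m ∣_) (lemma (eval p x) (eval p y)) (∣m∣n⇒∣m-n m∣p[x] (eval-cong p m∣x-y)))
    where lemma : ∀ a b → a - (a - b) ≡ b
          lemma = solve-∀

  monic : ∀ {d} → Vec ℤ d → Poly
  monic φ = toList φ ++ 1ℤ ∷ []

  eval-monic : ∀ {d} (φ : Vec ℤ d) x → eval (monic φ) x ≡ eval (toList φ) x + x ^ d
  eval-monic []      x = lemma x
    where lemma : ∀ x → 1ℤ + x * 0ℤ ≡ 0ℤ + 1ℤ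
          lemma = solve-∀
  eval-monic {suc d} (c ∷ φ) x rewrite eval-monic φ x = lemma c x (eval (toList φ) x) (x ^ d)
    where lemma : ∀ c x u v → c + x * (u + v) ≡ c + x * u + x * v
          lemma = solve-∀

  shiftIn : ∀ {n} → ℤ → Vec ℤ n → Vec ℤ n × ℤ
  shiftIn         c []      = [] , c
  shiftIn {suc n} c (a ∷ v) = prepend (shiftIn a v)
    where prepend : Vec ℤ n × ℤ → Vec ℤ (suc n) × ℤ
          prepend (w , t) = c ∷ w , t

  eval-shiftIn : ∀ {n} c (v : Vec ℤ n) x → let (w , t) = shiftIn c v in
                 c + x * eval (toList v) x ≡ eval (toList w) x + x ^ n * t
  eval-shiftIn c []      x = lemma c x
    where lemma : ∀ c x → c + x * 0ℤ ≡ 0ℤ + 1ℤ * c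
          lemma = solve-∀
  eval-shiftIn {suc n} c (a ∷ v) x = begin
    c + x * (a + x * eval (toList v) x)       ≡⟨ cong (λ u → c + x * u) (eval-shiftIn a v x) ⟩
    c + x * (eval (toList w) x + x ^ n * t)   ≡⟨ lemma c x (eval (toList w) x) (x ^ n) t ⟩
    c + x * eval (toList w) x + x * x ^ n * t ∎
    where
    open ≡-Reasoning
    w : Vec ℤ n
    w = proj₁ (shiftIn a v)
    t : ℤ
    t = proj₂ (shiftIn a v)
    lemma : ∀ c x u y t → c + x * (u + y * t) ≡ c + x * u + x * y * t
    lemma = solve-∀

  eval-zipWith-sub : ∀ {n} t (v w : Vec ℤ n) x →
    eval (toList (zipWith (λ a b → a - t * b) v w)) x ≡ eval (toList v) x - t * eval (toList w) x
  eval-zipWith-sub t []      []      x = lemma t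
    where lemma : ∀ t → 0ℤ ≡ 0ℤ - t * 0ℤ
          lemma = solve-∀
  eval-zipWith-sub t (a ∷ v) (b ∷ w) x rewrite eval-zipWith-sub t v w x =
    lemma t a b x (eval (toList v) x) (eval (toList w) x)
    where lemma : ∀ t a b x u v → a - t * b + x * (u - t * v) ≡ a + x * u - t * (b + x * v)
          lemma = solve-∀

  eval-zeros : ∀ n x → eval (toList (Vec.replicate n 0ℤ)) x ≡ 0ℤ
  eval-zeros zero    x = refl
  eval-zeros (suc n) x rewrite eval-zeros n x = lemma x
    where lemma : ∀ x → 0ℤ + x * 0ℤ ≡ 0ℤ
          lemma = solve-∀

  -- The type checker does not share repeated occurrences of a term, and every coefficient of
  -- p mod φ mentions the overflow coefficient of the previous step; forcing that coefficient
  -- keeps the evaluation of the certificates below linear instead of exponential.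
  seqℤ : {B : Set} → ℤ → (ℤ → B) → B
  seqℤ (+ n)    k = force n (λ n → k (+ n))
  seqℤ -[1+ n ] k = force n (λ n → k -[1+ n ])

  seqℤ-≡ : {B : Set} (t : ℤ) (k : ℤ → B) → seqℤ t k ≡ k t
  seqℤ-≡ (+ n)    k = force-≡ n (λ n → k (+ n))
  seqℤ-≡ -[1+ n ] k = force-≡ n (λ n → k -[1+ n ])

  infixl 5 _mod_

  _mod_ : ∀ {d} → Poly → Vec ℤ d → Vec ℤ d
  []      mod φ = Vec.replicate _ 0ℤ
  _mod_ {d} (c ∷ p) φ = subtractMultiple (shiftIn c (p mod φ))
    where subtractMultiple : Vec ℤ d × ℤ → Vec ℤ d
          subtractMultiple (v , t) = seqℤ t (λ t → zipWith (λ a b → a - t * b) v φ)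

  mod-sound : ∀ {d} p (φ : Vec ℤ d) x → eval (monic φ) x ∣ eval p x - eval (toList (p mod φ)) x
  mod-sound {d} []      φ x rewrite eval-zeros d x = divides 0ℤ refl
  mod-sound {d} (c ∷ p) φ x = subst (eval (monic φ) x ∣_) (sym eq)
    (∣m∣n⇒∣m+n (∣n⇒∣m*n x (mod-sound p φ x)) (∣n⇒∣m*n t ∣-refl))
    where
    open ≡-Reasoning
    r v : Vec ℤ d
    r = p mod φ
    v = proj₁ (shiftIn c r)
    t P R V F : ℤ
    t = proj₂ (shiftIn c r)
    P = eval p x
    R = eval (toList r) x
    V = eval (toList v) x
    F = eval (toList φ) x
    lemma : ∀ c x P R V F X t →
            c + x * P - (V - t * F) ≡ x * (P - R) + t * (F + X) + ((c + x * R) - (V + X * t))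
    lemma = solve-∀
    eq : c + x * P - eval (toList ((c ∷ p) mod φ)) x ≡ x * (P - R) + t * eval (monic φ) x
    eq = begin
      c + x * P - eval (toList ((c ∷ p) mod φ)) x
        ≡⟨ cong (λ z → c + x * P - eval (toList z) x) (seqℤ-≡ t (λ t → zipWith (λ a b → a - t * b) v φ)) ⟩
      c + x * P - eval (toList (zipWith (λ a b → a - t * b) v φ)) x
        ≡⟨ cong (λ z → c + x * P - z) (eval-zipWith-sub t v φ x) ⟩
      c + x * P - (V - t * F)
        ≡⟨ lemma c x P R V F (x ^ d) t ⟩
      x * (P - R) + t * (F + x ^ d) + ((c + x * R) - (V + x ^ d * t))
        ≡⟨ cong₂ (λ y z → x * (P - R) + t * y + z) (sym (eval-monic φ x))
             (trans (cong (_- (V + x ^ d * t)) (eval-shiftIn c r x)) (+-inverseʳ (V + x ^ d * t))) ⟩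
      x * (P - R) + t * eval (monic φ) x + 0ℤ
        ≡⟨ +-identityʳ _ ⟩
      x * (P - R) + t * eval (monic φ) x
        ∎

  evalℕ : List ℕ → ℕ → ℕ
  evalℕ []      x = 0
  evalℕ (c ∷ q) x = c ℕ.+ x ℕ.* evalℕ q x

  eval-map-+ : ∀ q x → eval (map +_ q) (+ x) ≡ + evalℕ q x
  eval-map-+ []      x = refl
  eval-map-+ (c ∷ q) x rewrite eval-map-+ q x =
    sym (trans (pos-+ c (x ℕ.* evalℕ q x)) (cong (λ z → + c + z) (pos-* x (evalℕ q x))))

  evalℕ-mono : ∀ q {x y} → x ℕ.≤ y → evalℕ q x ℕ.≤ evalℕ q y
  evalℕ-mono []      x≤y = ℕ.≤-refl
  evalℕ-mono (c ∷ q) x≤y = ℕ.+-monoʳ-≤ c (ℕ.*-mono-≤ x≤y (evalℕ-mono q x≤y))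

  nonNeg⇒map+∣∣≡id : ∀ {r} → All (0ℤ ≤_) r → map +_ (map ∣_∣ r) ≡ r
  nonNeg⇒map+∣∣≡id []          = refl
  nonNeg⇒map+∣∣≡id (0≤c ∷ 0≤r) = cong₂ _∷_ (0≤i⇒+∣i∣≡i 0≤c) (nonNeg⇒map+∣∣≡id 0≤r)

  eval-mono-from-2 : ∀ p → All (0ℤ ≤_) (translate (+ 2) p) →
                     ∀ {α} → 2 ℕ.≤ α → ∣ eval p (+ 2) ∣ ℕ.≤ ∣ eval p (+ α) ∣
  eval-mono-from-2 p 0≤r {α} 2≤α =
    subst₂ ℕ._≤_ (cong ∣_∣ (value-at 0)) (cong ∣_∣ (trans (value-at (α ℕ.∸ 2)) (cong (eval p) α≡s+2)))
      (evalℕ-mono q ℕ.z≤n)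
    where
    q : List ℕ
    q = map ∣_∣ (translate (+ 2) p)
    value-at : ∀ s → + evalℕ q s ≡ eval p (+ s + + 2)
    value-at s = begin
      + evalℕ q s                      ≡⟨ eval-map-+ q s ⟨
      eval (map +_ q) (+ s)            ≡⟨ cong (λ r → eval r (+ s)) (nonNeg⇒map+∣∣≡id 0≤r) ⟩
      eval (translate (+ 2) p) (+ s)   ≡⟨ eval-translate (+ 2) p (+ s) ⟩
      eval p (+ s + + 2)               ∎
      where open ≡-Reasoning
    α≡s+2 : + (α ℕ.∸ 2) + + 2 ≡ + α
    α≡s+2 = trans (sym (pos-+ (α ℕ.∸ 2) 2)) (cong +_ (ℕ.m∸n+n≡m 2≤α))

module Arithmetic where

  open import Data.Nat.Base
    using (ℕ; zero; suc; _+_; _*_; _∸_; _^_; _≤_; _<_; z≤n; s≤s; >-nonZero; n>1⇒nonTrivial)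
  open import Data.Nat.Divisibility
    using (hasNonTrivialDivisor; _∣_; _∣0; ∣-refl; ∣-reflexive; ∣m∣n⇒∣m+n; ∣n⇒∣m*n; ∣m⇒∣m*n)
  open import Data.Nat.Induction using (<-rec)
  open import Data.Nat.Primality using (Composite)
  open import Data.Nat.Properties
    using (+-suc; +-identityʳ; *-identityʳ; +-comm; *-comm; ^-distribˡ-+-*; ≤-trans; m≤n+m; m≤m*n; m<m*n)
  open import Data.Nat.Tactic.RingSolver using (solve-∀)
  open import Relation.Binary.PropositionalEquality using (_≡_; trans; cong; cong₂; subst; module ≡-Reasoning)

  U⁺ : ℕ → ℕ → ℕ
  U⁺ n α = U n α + (α ∸ 1) ^ 2

  U-+ : ∀ m n α → U (m + n) α ≡ U m α + α ^ m * U n α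
  U-+ m zero    α rewrite +-identityʳ m = lemma (U m α) (α ^ m)
    where lemma : ∀ u a → u ≡ u + a * 0
          lemma = solve-∀
  U-+ m (suc n) α = begin
    U (m + suc n) α                          ≡⟨ cong (λ k → U k α) (+-suc m n) ⟩
    α ^ (m + n) + U (m + n) α                ≡⟨ cong₂ _+_ (^-distribˡ-+-* α m n) (U-+ m n α) ⟩
    α ^ m * α ^ n + (U m α + α ^ m * U n α)  ≡⟨ lemma (α ^ m) (α ^ n) (U m α) (U n α) ⟩
    U m α + α ^ m * (α ^ n + U n α)          ∎
    where
    open ≡-Reasoning
    lemma : ∀ a b u v → a * b + (u + a * v) ≡ u + a * (b + v)
    lemma = solve-∀

  U-suc : ∀ n α → U (suc n) α ≡ 1 + α * U n α
  U-suc n α = trans (U-+ 1 n α) (cong (λ a → 1 + a * U n α) (*-identityʳ α))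

  U[j]∣U[t*j] : ∀ j t α → U j α ∣ U (t * j) α
  U[j]∣U[t*j] j zero    α = U j α ∣0
  U[j]∣U[t*j] j (suc t) α rewrite U-+ j (t * j) α =
    ∣m∣n⇒∣m+n ∣-refl (∣n⇒∣m*n (α ^ j) (U[j]∣U[t*j] j t α))

  1≤U : ∀ n α → 1 ≤ n → 1 ≤ U n α
  1≤U (suc zero)    α _ = s≤s z≤n
  1≤U (suc (suc n)) α _ = ≤-trans (1≤U (suc n) α (s≤s z≤n)) (m≤n+m (U (suc n) α) (α ^ suc n))

  divisor⇒composite : ∀ {d k s} → 2 ≤ d → d ≤ k → 1 ≤ s → d ∣ k * s + 1 → Composite (k * s + 1)
  divisor⇒composite {d} {k} {s} 2≤d d≤k 1≤s d∣ks+1 =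
    hasNonTrivialDivisor {{n>1⇒nonTrivial 2≤d}} d<ks+1 d∣ks+1
    where
    d<ks+1 : d < k * s + 1
    d<ks+1 = subst (d <_) (+-comm 1 (k * s)) (s≤s (≤-trans d≤k (m≤m*n k s {{>-nonZero 1≤s}})))

  data Parity : ℕ → Set where
    even : ∀ k → Parity (k * 2)
    odd  : ∀ k → Parity (suc (k * 2))

  parity : ∀ n → Parity n
  parity zero    = even 0
  parity (suc n) with parity n
  ... | even k = odd k
  ... | odd k  = even (suc k)

  data Shape : ℕ → Set where
    oddDivisor       : ∀ {n} h → 3 + 2 * h ∣ n → Shape n
    powerOfFour      : ∀ t → Shape (4 ^ t)
    twicePowerOfFour : ∀ t → Shape (2 * 4 ^ t)

  shape : ∀ n → 1 ≤ n → Shape n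
  shape = <-rec (λ n → 1 ≤ n → Shape n) step
    where
    double : ∀ {n} → Shape n → Shape (n * 2)
    double (oddDivisor h q∣n)   = oddDivisor h (∣m⇒∣m*n 2 q∣n)
    double (powerOfFour t)      = subst Shape (*-comm 2 (4 ^ t)) (twicePowerOfFour t)
    double (twicePowerOfFour t) = subst Shape (lemma (4 ^ t)) (powerOfFour (suc t))
      where lemma : ∀ a → 4 * a ≡ 2 * a * 2
            lemma = solve-∀
    step : ∀ n → (∀ {m} → m < n → 1 ≤ m → Shape m) → 1 ≤ n → Shape n
    step n rec 1≤n with parity n
    step .(suc k * 2)       rec _ | even (suc k) = double (rec (m<m*n (suc k) 2 (s≤s (s≤s z≤n))) (s≤s z≤n))
    step .1                 rec _ | odd zero     = powerOfFour 0
    step .(suc (suc h * 2)) rec _ | odd (suc h)  = oddDivisor h (∣-reflexive (lemma h))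
      where lemma : ∀ h → 3 + 2 * h ≡ suc (suc h * 2)
            lemma = solve-∀

module Congruences where

  open import Data.Integer.Base using (ℤ; +_; 0ℤ; 1ℤ; -_; _+_; _-_; _*_; _^_)
  open import Data.Integer.DivMod using (_%ℕ_; _/ℕ_; a≡a%ℕn+[a/ℕn]*n)
  open import Data.Integer.Divisibility.Signed
    using (_∣_; divides; ∣-trans; ∣m∣n⇒∣m+n; ∣n⇒∣m*n; ∣m⇒∣m*n; ∣ᵤ⇒∣)
  open import Data.Integer.Properties using (pos-+; pos-*; *-identityʳ)
  open import Data.Integer.Tactic.RingSolver using (solve-∀)
  open import Data.List.Base using (List; []; _∷_; map)
  open import Data.List.Membership.Propositional using (_∈_)
  open import Data.List.Membership.Propositional.Properties using (∈-map⁺)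
  open import Data.List.Relation.Unary.All using (All; []; _∷_)
  import Data.List.Relation.Unary.All.Properties as All
  open import Data.List.Relation.Unary.AllPairs using (AllPairs; []; _∷_)
  open import Data.List.Relation.Unary.Any using (here; there)
  open import Data.Nat.Base as ℕ using (ℕ; zero; suc; _≤_; _<_; NonZero)
  open import Data.Nat.Coprimality using (Coprime; coprime-Bézout; coprime-divisor)
  import Data.Nat.Divisibility as ℕ
  open import Data.Nat.GCD using (module Bézout)
  open import Data.Nat.ListAction using (product)
  open import Data.Nat.ListAction.Properties using (∈⇒∣product)
  open import Data.Nat.Primality using (Prime; prime⇒irreducible)
  import Data.Nat.Properties as ℕ
  open import Data.Product.Base using (∃; ∃₂; _×_; _,_; proj₁; proj₂)
  open import Data.Sum.Base using (inj₁; inj₂)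
  open import Function.Base using (_on_)
  open import Relation.Nullary.Negation using (¬_; contradiction)
  open import Relation.Binary.PropositionalEquality
    using (_≡_; refl; sym; trans; cong; cong₂; subst; module ≡-Reasoning)

  pos-^ : ∀ x n → + (x ℕ.^ n) ≡ (+ x) ^ n
  pos-^ x zero    = refl
  pos-^ x (suc n) = trans (pos-* x (x ℕ.^ n)) (cong (λ z → + x * z) (pos-^ x n))

  ∣-^-cong : ∀ {m x y} n → m ∣ x - y → m ∣ x ^ n - y ^ n
  ∣-^-cong zero    _ = divides 0ℤ refl
  ∣-^-cong {m} {x} {y} (suc n) m∣x-y = subst (m ∣_) (lemma x y (x ^ n) (y ^ n))
    (∣m∣n⇒∣m+n (∣n⇒∣m*n x (∣-^-cong n m∣x-y)) (∣m⇒∣m*n (y ^ n) m∣x-y))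
    where lemma : ∀ x y a b → x * (a - b) + (x - y) * b ≡ x * a - y * b
          lemma = solve-∀

  coprime-* : ∀ {m a b} → Coprime m a → Coprime m b → Coprime m (a ℕ.* b)
  coprime-* {m} {a} m⊥a m⊥b {d} (d∣m , d∣ab) = m⊥b (d∣m , coprime-divisor d⊥a d∣ab)
    where d⊥a : Coprime d a
          d⊥a (e∣d , e∣a) = m⊥a (ℕ.∣-trans e∣d d∣m , e∣a)

  coprime-product : ∀ {m ns} → All (Coprime m) ns → Coprime m (product ns)
  coprime-product []           (_ , d∣1) = ℕ.∣1⇒≡1 d∣1
  coprime-product (m⊥n ∷ m⊥ns) = coprime-* m⊥n (coprime-product m⊥ns)

  prime∤⇒coprime : ∀ {p m} → Prime p → ¬ p ℕ.∣ m → Coprime m p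
  prime∤⇒coprime p-prime p∤m (d∣m , d∣p) with prime⇒irreducible p-prime d∣p
  ... | inj₁ d≡1  = d≡1
  ... | inj₂ refl = contradiction d∣m p∤m

  bézout : ∀ {a b} → Coprime a b → ∃₂ λ u v → u * + a + v * + b ≡ 1ℤ
  bézout {a} {b} a⊥b with coprime-Bézout a⊥b
  ... | Bézout.+- x y eq = + x , - + y , (begin
    + x * + a + - + y * + b           ≡⟨ cong (λ z → z + - + y * + b) (sym (pos-* x a)) ⟩
    + (x ℕ.* a) + - + y * + b         ≡⟨ cong (λ z → + z + - + y * + b) (sym eq) ⟩
    + (1 ℕ.+ y ℕ.* b) + - + y * + b   ≡⟨ cong (λ z → 1ℤ + z + - + y * + b) (pos-* y b) ⟩
    1ℤ + + y * + b + - + y * + b      ≡⟨ lemma (+ y) (+ b) ⟩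
    1ℤ                                ∎)
    where open ≡-Reasoning
          lemma : ∀ y b → 1ℤ + y * b + - y * b ≡ 1ℤ
          lemma = solve-∀
  ... | Bézout.-+ x y eq = - + x , + y , (begin
    - + x * + a + + y * + b           ≡⟨ cong (λ z → - + x * + a + z) (sym (pos-* y b)) ⟩
    - + x * + a + + (y ℕ.* b)         ≡⟨ cong (λ z → - + x * + a + + z) (sym eq) ⟩
    - + x * + a + + (1 ℕ.+ x ℕ.* a)   ≡⟨ cong (λ z → - + x * + a + (1ℤ + z)) (pos-* x a) ⟩
    - + x * + a + (1ℤ + + x * + a)    ≡⟨ lemma (+ x) (+ a) ⟩
    1ℤ                                ∎)
    where open ≡-Reasoning
          lemma : ∀ x a → - x * a + (1ℤ + x * a) ≡ 1ℤ
          lemma = solve-∀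

  chinese-remainder : ∀ {A : Set} (m : A → ℕ) (c : A → ℤ) {xs : List A} →
                      AllPairs (Coprime on m) xs → ∃ λ k → ∀ {x} → x ∈ xs → + (m x) ∣ k - c x
  chinese-remainder m c {[]}     []                   = 0ℤ , λ ()
  chinese-remainder m c {x ∷ xs} (x⊥xs ∷ xs-pairwise) = k , solves
    where
    rest : ∃ λ k → ∀ {y} → y ∈ xs → + (m y) ∣ k - c y
    rest = chinese-remainder m c xs-pairwise
    uv : ∃₂ λ u v → u * + m x + v * + product (map m xs) ≡ 1ℤ
    uv = bézout (coprime-product (All.map⁺ x⊥xs))
    k₀ M P u v k : ℤ
    k₀ = proj₁ rest
    M  = + m x
    P  = + product (map m xs)
    u  = proj₁ uv
    v  = proj₁ (proj₂ uv)
    k  = k₀ * u * M + c x * v * P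

    k-via-bézout : ∀ a → k - a ≡ k - a * (u * M + v * P)
    k-via-bézout a = cong (λ z → k - z) (trans (sym (*-identityʳ a)) (cong (a *_) (sym (proj₂ (proj₂ uv)))))

    k≡c[x] : k - c x ≡ (k₀ - c x) * u * M
    k≡c[x] = trans (k-via-bézout (c x)) (lemma k₀ (c x) u v M P)
      where lemma : ∀ k₀ c u v M P → k₀ * u * M + c * v * P - c * (u * M + v * P) ≡ (k₀ - c) * u * M
            lemma = solve-∀

    k≡k₀ : k - k₀ ≡ (c x - k₀) * v * P
    k≡k₀ = trans (k-via-bézout k₀) (lemma k₀ (c x) u v M P)
      where lemma : ∀ k₀ c u v M P → k₀ * u * M + c * v * P - k₀ * (u * M + v * P) ≡ (c - k₀) * v * P
            lemma = solve-∀

    solves : ∀ {y} → y ∈ x ∷ xs → + (m y) ∣ k - c y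
    solves (here refl)      = divides ((k₀ - c x) * u) k≡c[x]
    solves {y} (there y∈xs) = subst (+ (m y) ∣_) (lemma k k₀ (c y))
      (∣m∣n⇒∣m+n (∣-trans m[y]∣P (divides ((c x - k₀) * v) k≡k₀)) (proj₂ rest y∈xs))
      where
      m[y]∣P : + (m y) ∣ P
      m[y]∣P = ∣ᵤ⇒∣ (∈⇒∣product (∈-map⁺ m y∈xs))
      lemma : ∀ k k₀ c → k - k₀ + (k₀ - c) ≡ k - c
      lemma = solve-∀

  invertible-mod : ∀ {m d} s t → Coprime m d → + m ∣ s * t - + d → ∃ λ c → + m ∣ c * s + 1ℤ
  invertible-mod {m} {d} s t m⊥d (divides q eq) = - (v * t) , divides (u - v * q) (begin
    - (v * t) * s + 1ℤ                    ≡⟨ cong (λ z → - (v * t) * s + z) (proj₂ (proj₂ uv)) ⟨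
    - (v * t) * s + (u * + m + v * + d)   ≡⟨ lemma u v s t (+ m) (+ d) ⟩
    u * + m - v * (s * t - + d)           ≡⟨ cong (λ z → u * + m - v * z) eq ⟩
    u * + m - v * (q * + m)               ≡⟨ lemma′ u v q (+ m) ⟩
    (u - v * q) * + m                     ∎)
    where
    open ≡-Reasoning
    uv : ∃₂ λ u v → u * + m + v * + d ≡ 1ℤ
    uv = bézout m⊥d
    u v : ℤ
    u = proj₁ uv
    v = proj₁ (proj₂ uv)
    lemma : ∀ u v s t m d → - (v * t) * s + (u * m + v * d) ≡ u * m - v * (s * t - d)
    lemma = solve-∀
    lemma′ : ∀ u v q m → u * m - v * (q * m) ≡ (u - v * q) * m
    lemma′ = solve-∀

  representative-above : ∀ P .{{_ : NonZero P}} (a : ℤ) m → ∃ λ k → m < k × P ≤ k × + P ∣ + k - a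
  representative-above P a m = k , m<k , P≤k , divides (+ suc m - a /ℕ P) (begin
    + k - a                                    ≡⟨ cong₂ _-_ +k≡ (a≡a%ℕn+[a/ℕn]*n a P) ⟩
    + r + + P * + suc m - (+ r + a /ℕ P * + P) ≡⟨ lemma (+ r) (+ P) (+ suc m) (a /ℕ P) ⟩
    (+ suc m - a /ℕ P) * + P                   ∎)
    where
    open ≡-Reasoning
    r k : ℕ
    r = a %ℕ P
    k = r ℕ.+ P ℕ.* suc m
    +k≡ : + k ≡ + r + + P * + suc m
    +k≡ = trans (pos-+ r (P ℕ.* suc m)) (cong (λ z → + r + z) (pos-* P (suc m)))
    m<k : m < k
    m<k = ℕ.≤-trans (ℕ.m≤n*m (suc m) P) (ℕ.m≤n+m (P ℕ.* suc m) r)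
    P≤k : P ≤ k
    P≤k = ℕ.≤-trans (ℕ.m≤m*n P (suc m)) (ℕ.m≤n+m (P ℕ.* suc m) r)
    lemma : ∀ r P s q → r + P * s - (r + q * P) ≡ (s - q) * P
    lemma = solve-∀

module CoveringSystems where

  open Arithmetic using (U⁺; U-+; U[j]∣U[t*j]; 1≤U; divisor⇒composite)
  open Congruences using (chinese-remainder; representative-above)
  open import Data.Fin.Base using (Fin; toℕ; fromℕ<)
  import Data.Fin.Properties as Fin
  open import Data.Integer.Base using (ℤ; +_; 1ℤ; _+_; _-_; _*_)
  open import Data.Integer.Divisibility.Signed
    using (_∣_; ∣-trans; ∣m∣n⇒∣m+n; ∣n⇒∣m*n; ∣m⇒∣m*n; ∣ᵤ⇒∣; ∣⇒∣ᵤ)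
  open import Data.Integer.Properties using (pos-+; pos-*)
  open import Data.Integer.Tactic.RingSolver using (solve-∀)
  open import Data.List.Base using (List; map)
  open import Data.List.Membership.Propositional using (_∈_; find; lose)
  open import Data.List.Membership.Propositional.Properties using (∈-map⁺)
  open import Data.List.Relation.Unary.All as All using (All; tabulate)
  import Data.List.Relation.Unary.All.Properties as All
  open import Data.List.Relation.Unary.AllPairs using (AllPairs)
  open import Data.List.Relation.Unary.Any as Any using (Any)
  open import Data.Nat.Base as ℕ using (ℕ; _≤_; _<_; NonZero; >-nonZero; _%_; _/_; z≤n; s≤s)
  open import Data.Nat.Coprimality using (Coprime)
  import Data.Nat.Divisibility as ℕ
  open import Data.Nat.DivMod using (m≡m%n+[m/n]*n; m%n<n; m∣n⇒o%n%m≡o%m)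
  open import Data.Nat.ListAction using (product)
  open import Data.Nat.ListAction.Properties using (∈⇒∣product; ∈⇒≤product; product≢0)
  open import Data.Nat.Primality using (Composite)
  import Data.Nat.Properties as ℕ
  import Data.Nat.Tactic.RingSolver as ℕ-Solver
  open import Data.Product.Base using (∃; _×_; _,_; proj₁; proj₂)
  open import Function.Base using (_on_)
  open import Relation.Nullary.Decidable using (True; toWitness)
  open import Relation.Binary.PropositionalEquality using (_≡_; sym; trans; cong; subst; module ≡-Reasoning)

  record CoveringClass (α : ℕ) : Set where
    field
      period residue modulus : ℕ
      {{period≢0}}  : NonZero period
      2≤modulus     : 2 ≤ modulus
      modulus∣U     : modulus ℕ.∣ U period α
      kClass        : ℤ
      modulus∣kU⁺+1 : + modulus ∣ kClass * + U⁺ residue α + 1ℤ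

  open CoveringClass public

  U⁺-period : ∀ α r j t → U⁺ (r ℕ.+ t ℕ.* j) α ≡ U⁺ r α ℕ.+ α ℕ.^ r ℕ.* U (t ℕ.* j) α
  U⁺-period α r j t = begin
    U (r ℕ.+ t ℕ.* j) α ℕ.+ s                  ≡⟨ cong (ℕ._+ s) (U-+ r (t ℕ.* j) α) ⟩
    U r α ℕ.+ α ℕ.^ r ℕ.* U (t ℕ.* j) α ℕ.+ s  ≡⟨ lemma (U r α) (α ℕ.^ r ℕ.* U (t ℕ.* j) α) s ⟩
    U r α ℕ.+ s ℕ.+ α ℕ.^ r ℕ.* U (t ℕ.* j) α  ∎
    where
    open ≡-Reasoning
    s : ℕ
    s = (α ℕ.∸ 1) ℕ.^ 2
    lemma : ∀ u w s → u ℕ.+ w ℕ.+ s ≡ u ℕ.+ s ℕ.+ w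
    lemma = ℕ-Solver.solve-∀

  covered-divides : ∀ {α} (C : CoveringClass α) {n k} → n % period C ≡ residue C →
                    + modulus C ∣ + k - kClass C → modulus C ℕ.∣ k ℕ.* U⁺ n α ℕ.+ 1
  covered-divides {α} C {n} {k} n%j≡r k≡c = ∣⇒∣ᵤ (subst (+ modulus C ∣_) (sym N≡) M∣N)
    where
    open ≡-Reasoning
    r t W : ℕ
    r = residue C
    t = n / period C
    W = U (t ℕ.* period C) α
    S A : ℤ
    S = + U⁺ r α
    A = + (α ℕ.^ r)
    n≡r+tj : n ≡ r ℕ.+ t ℕ.* period C
    n≡r+tj = trans (m≡m%n+[m/n]*n n (period C)) (cong (ℕ._+ t ℕ.* period C) n%j≡r)
    N≡ : + (k ℕ.* U⁺ n α ℕ.+ 1) ≡ (kClass C * S + 1ℤ) + (+ k - kClass C) * S + + k * (A * + W)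
    N≡ = begin
      + (k ℕ.* U⁺ n α ℕ.+ 1)
        ≡⟨ cong (λ n → + (k ℕ.* U⁺ n α ℕ.+ 1)) n≡r+tj ⟩
      + (k ℕ.* U⁺ (r ℕ.+ t ℕ.* period C) α ℕ.+ 1)
        ≡⟨ cong (λ x → + (k ℕ.* x ℕ.+ 1)) (U⁺-period α r (period C) t) ⟩
      + (k ℕ.* (U⁺ r α ℕ.+ α ℕ.^ r ℕ.* W) ℕ.+ 1)
        ≡⟨ trans (pos-+ _ 1) (cong (_+ 1ℤ) (trans (pos-* k _) (cong (+ k *_)
             (trans (pos-+ (U⁺ r α) _) (cong (λ z → S + z) (pos-* (α ℕ.^ r) W)))))) ⟩
      + k * (S + A * + W) + 1ℤ
        ≡⟨ lemma (+ k) (kClass C) S A (+ W) ⟩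
      (kClass C * S + 1ℤ) + (+ k - kClass C) * S + + k * (A * + W)
        ∎
      where lemma : ∀ k c S A W → k * (S + A * W) + 1ℤ ≡ (c * S + 1ℤ) + (k - c) * S + k * (A * W)
            lemma = solve-∀
    M∣W : + modulus C ∣ + W
    M∣W = ∣ᵤ⇒∣ (ℕ.∣-trans (modulus∣U C) (U[j]∣U[t*j] (period C) t α))
    M∣N : + modulus C ∣ (kClass C * S + 1ℤ) + (+ k - kClass C) * S + + k * (A * + W)
    M∣N = ∣m∣n⇒∣m+n (∣m∣n⇒∣m+n (modulus∣kU⁺+1 C) (∣m⇒∣m*n S k≡c)) (∣n⇒∣m*n (+ k) (∣n⇒∣m*n A M∣W))

  composite-from-covering : ∀ {α} (cls : List (CoveringClass α)) →
    AllPairs (Coprime on modulus) cls → (∀ n → Any (λ C → n % period C ≡ residue C) cls) →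
    ∀ m → ∃ λ k → m < k × (∀ n → 1 ≤ n → Composite (k ℕ.* U⁺ n α ℕ.+ 1))
  composite-from-covering {α} cls pairwise covers m = k , m<k , composite
    where
    P : ℕ
    P = product (map modulus cls)
    moduli≢0 : All NonZero (map modulus cls)
    moduli≢0 = All.map⁺ (tabulate (λ {C} _ → >-nonZero (ℕ.≤-trans (s≤s z≤n) (2≤modulus C))))
    instance
      P≢0 : NonZero P
      P≢0 = product≢0 moduli≢0
    crt : ∃ λ k₀ → ∀ {C} → C ∈ cls → + modulus C ∣ k₀ - kClass C
    crt = chinese-remainder modulus kClass pairwise
    k₀ : ℤ
    k₀ = proj₁ crt
    rep : ∃ λ k → m < k × P ≤ k × + P ∣ + k - k₀
    rep = representative-above P k₀ m
    k : ℕ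
    k = proj₁ rep
    m<k : m < k
    m<k = proj₁ (proj₂ rep)
    composite : ∀ n → 1 ≤ n → Composite (k ℕ.* U⁺ n α ℕ.+ 1)
    composite n 1≤n with find (covers n)
    ... | C , C∈cls , n%j≡r = divisor⇒composite (2≤modulus C)
      (ℕ.≤-trans (∈⇒≤product moduli≢0 (∈-map⁺ modulus C∈cls)) (proj₁ (proj₂ (proj₂ rep))))
      (ℕ.≤-trans (1≤U n α 1≤n) (ℕ.m≤m+n (U n α) _))
      (covered-divides C n%j≡r k≡c)
      where
      M∣P : + modulus C ∣ + P
      M∣P = ∣ᵤ⇒∣ (∈⇒∣product (∈-map⁺ modulus C∈cls))
      k≡c : + modulus C ∣ + k - kClass C
      k≡c = subst (+ modulus C ∣_) (lemma (+ k) k₀ (kClass C))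
        (∣m∣n⇒∣m+n (∣-trans M∣P (proj₂ (proj₂ (proj₂ rep)))) (proj₂ crt C∈cls))
        where lemma : ∀ k k₀ c → k - k₀ + (k₀ - c) ≡ k - c
              lemma = solve-∀

  covered-by-residues : ∀ {α} L .{{_ : NonZero L}} (cls : List (CoveringClass α)) →
    {_ : True (All.all? (λ C → period C ℕ.∣? L) cls)} →
    {_ : True (Fin.all? (λ (i : Fin L) → Any.any? (λ C → toℕ i % period C ℕ.≟ residue C) cls))} →
    ∀ n → Any (λ C → n % period C ≡ residue C) cls
  covered-by-residues L cls {periods∣L} {residues-covered} n
    with find (toWitness residues-covered (fromℕ< (m%n<n n L)))
  ... | C , C∈cls , i%j≡r = lose C∈cls (begin
    n % period C                         ≡⟨ m∣n⇒o%n%m≡o%m (period C) L n j∣L ⟨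
    n % L % period C                     ≡⟨ cong (_% period C) (Fin.toℕ-fromℕ< (m%n<n n L)) ⟨
    toℕ (fromℕ< (m%n<n n L)) % period C  ≡⟨ i%j≡r ⟩
    residue C                            ∎)
    where
    open ≡-Reasoning
    j∣L : period C ℕ.∣ L
    j∣L = All.lookup (toWitness periods∣L) C∈cls

module OddDivisor where

  open Arithmetic using (U⁺; U-suc; 1≤U; divisor⇒composite)
  open import Data.Integer.Base using (ℤ; +_; 1ℤ; _+_; _-_; _*_)
  open import Data.Integer.Divisibility.Signed using (divides; ∣⇒∣ᵤ)
  open import Data.Integer.Properties using (pos-+; pos-*)
  open import Data.Integer.Tactic.RingSolver using (solve-∀)
  open import Data.Nat.Base as ℕ using (ℕ; suc; _≤_; _<_; z≤n; s≤s)
  import Data.Nat.Divisibility as ℕ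
  open import Data.Nat.Primality using (Composite)
  import Data.Nat.Properties as ℕ
  open import Data.Product.Base using (∃; _×_; _,_)
  open import Relation.Binary.PropositionalEquality using (_≡_; trans; cong; cong₂; module ≡-Reasoning)

  pos-U⁺[1+n] : ∀ n a → + U⁺ (suc n) (suc a) ≡ 1ℤ + + suc a * + U n (suc a) + + a * + a
  pos-U⁺[1+n] n a = begin
    + (U (suc n) (suc a) ℕ.+ a ℕ.^ 2)            ≡⟨ pos-+ (U (suc n) (suc a)) (a ℕ.^ 2) ⟩
    + U (suc n) (suc a) + + (a ℕ.^ 2)            ≡⟨ cong₂ _+_ (cong +_ (U-suc n (suc a))) +a²≡ ⟩
    + (1 ℕ.+ suc a ℕ.* U n (suc a)) + + a * + a  ≡⟨ cong (_+ + a * + a) +1+αU≡ ⟩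
    1ℤ + + suc a * + U n (suc a) + + a * + a     ∎
    where
    open ≡-Reasoning
    +a²≡ : + (a ℕ.^ 2) ≡ + a * + a
    +a²≡ = trans (pos-* a (a ℕ.* 1)) (cong (λ z → + a * + z) (ℕ.*-identityʳ a))
    +1+αU≡ : + (1 ℕ.+ suc a ℕ.* U n (suc a)) ≡ 1ℤ + + suc a * + U n (suc a)
    +1+αU≡ = trans (pos-+ 1 _) (cong (λ z → 1ℤ + z) (pos-* (suc a) _))

  odd-divisor-identity : ∀ h m e u → let q = + 3 + + 2 * h; k = 1ℤ + h + q * (1ℤ + m); α = e * q in
    k * (1ℤ + α * u + (α - 1ℤ) * (α - 1ℤ)) + 1ℤ ≡ (+ 2 * m + + 3 + k * e * (u + α - + 2)) * q
  odd-divisor-identity = solve-∀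

  odd-divisor-case : ∀ {α} h → 3 ℕ.+ 2 ℕ.* h ℕ.∣ α → 1 ≤ α →
    ∀ m → ∃ λ k → m < k × (∀ n → 1 ≤ n → Composite (k ℕ.* U⁺ n α ℕ.+ 1))
  odd-divisor-case {suc a} h (ℕ.divides e α≡eq) _ m = k , m<k , composite
    where
    q k : ℕ
    q = 3 ℕ.+ 2 ℕ.* h
    k = suc h ℕ.+ q ℕ.* suc m
    m<k : m < k
    m<k = ℕ.≤-trans (ℕ.m≤n*m (suc m) q) (ℕ.m≤n+m (q ℕ.* suc m) (suc h))
    q≤k : q ≤ k
    q≤k = ℕ.≤-trans (ℕ.m≤m*n q (suc m)) (ℕ.m≤n+m (q ℕ.* suc m) (suc h))
    H M E Q K A : ℤ
    H = + h
    M = + m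
    E = + e
    Q = + 3 + + 2 * H
    K = 1ℤ + H + Q * (1ℤ + M)
    A = E * Q
    +q≡ : + q ≡ Q
    +q≡ = trans (pos-+ 3 (2 ℕ.* h)) (cong (λ z → + 3 + z) (pos-* 2 h))
    +k≡ : + k ≡ K
    +k≡ = trans (pos-+ (suc h) (q ℕ.* suc m)) (cong (λ z → 1ℤ + H + z) (trans (pos-* q (suc m)) (cong (_* (1ℤ + M)) +q≡)))
    +α≡ : + suc a ≡ A
    +α≡ = trans (cong +_ α≡eq) (trans (pos-* e q) (cong (E *_) +q≡))
    +a≡ : + a ≡ A - 1ℤ
    +a≡ = trans (lemma (+ a)) (cong (_- 1ℤ) +α≡)
      where lemma : ∀ x → x ≡ 1ℤ + x - 1ℤ
            lemma = solve-∀
    composite : ∀ n → 1 ≤ n → Composite (k ℕ.* U⁺ n (suc a) ℕ.+ 1)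
    composite (suc n) 1≤n = divisor⇒composite (s≤s (s≤s z≤n)) q≤k
      (ℕ.≤-trans (1≤U (suc n) (suc a) 1≤n) (ℕ.m≤m+n _ _))
      (∣⇒∣ᵤ (divides quotient (begin
        + (k ℕ.* U⁺ (suc n) (suc a) ℕ.+ 1)           ≡⟨ trans (pos-+ _ 1) (cong (_+ 1ℤ) (pos-* k _)) ⟩
        + k * + U⁺ (suc n) (suc a) + 1ℤ              ≡⟨ cong₂ (λ x y → x * y + 1ℤ) +k≡ +U⁺≡ ⟩
        K * (1ℤ + A * u + (A - 1ℤ) * (A - 1ℤ)) + 1ℤ  ≡⟨ odd-divisor-identity H M E u ⟩
        quotient * Q                                 ≡⟨ cong (quotient *_) +q≡ ⟨
        quotient * + q                               ∎)))
      where
      open ≡-Reasoning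
      u quotient : ℤ
      u = + U n (suc a)
      quotient = + 2 * M + + 3 + K * E * (u + A - + 2)
      +U⁺≡ : + U⁺ (suc n) (suc a) ≡ 1ℤ + A * u + (A - 1ℤ) * (A - 1ℤ)
      +U⁺≡ = trans (pos-U⁺[1+n] n a) (cong₂ (λ x y → 1ℤ + x * u + y * y) +α≡ +a≡)

module Certificates where

  open Polynomials
  open Arithmetic using (U⁺; U-suc)
  open Congruences using (coprime-product; prime∤⇒coprime; invertible-mod)
  open CoveringSystems using (CoveringClass)
  open import Data.Integer.Base using (ℤ; +_; -[1+_]; 0ℤ; 1ℤ; ∣_∣; _≤_; _+_; _-_; _*_)
  open import Data.Integer.Divisibility.Signed using (_∣_; ∣-trans; ∣m∣∣m; ∣ᵤ⇒∣; ∣⇒∣ᵤ; ∣m∣n⇒∣m-n; ∣n⇒∣m*n)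
  open import Data.Integer.Properties using (_≤?_; pos-+; pos-*; +-identityʳ)
  open import Data.Integer.Tactic.RingSolver using (solve-∀)
  open import Data.List.Base using (List; []; _∷_; replicate)
  open import Data.List.Relation.Unary.All as All using (All; all?)
  open import Data.Nat.Base as ℕ using (ℕ; zero; suc; NonZero)
  open import Data.Nat.Coprimality using (Coprime)
  open import Data.Nat.ListAction using (product)
  open import Data.Nat.Primality using (Prime; prime?)
  import Data.Nat.Properties as ℕ
  open import Data.Product.Base using (∃; _×_; _,_; proj₁; proj₂)
  open import Data.Vec.Base as Vec using (Vec; _∷_; toList)
  open import Relation.Nullary.Decidable using (True; toWitness)
  open import Relation.Nullary.Negation using (¬_)
  open import Relation.Binary.PropositionalEquality
    using (_≡_; refl; sym; trans; cong; cong₂; subst; module ≡-Reasoning)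

  eval-ones : ∀ n α → eval (replicate n 1ℤ) (+ α) ≡ + U n α
  eval-ones zero    α = refl
  eval-ones (suc n) α rewrite eval-ones n α =
    sym (trans (cong +_ (U-suc n α)) (trans (pos-+ 1 _) (cong (λ z → 1ℤ + z) (pos-* α (U n α)))))

  U⁺-poly : ℕ → Poly
  U⁺-poly r = replicate r 1ℤ ⊕ (1ℤ ∷ -[1+ 1 ] ∷ 1ℤ ∷ [])

  eval-U⁺-poly : ∀ r {α} → 1 ℕ.≤ α → eval (U⁺-poly r) (+ α) ≡ + U⁺ r α
  eval-U⁺-poly r {suc a} _ = begin
    eval (U⁺-poly r) (+ suc a)
      ≡⟨ eval-⊕ (replicate r 1ℤ) _ (+ suc a) ⟩
    eval (replicate r 1ℤ) (+ suc a) + eval (1ℤ ∷ -[1+ 1 ] ∷ 1ℤ ∷ []) (+ suc a)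
      ≡⟨ cong₂ _+_ (eval-ones r (suc a)) (lemma (+ a)) ⟩
    + U r (suc a) + + a * + a
      ≡⟨ cong (λ z → + U r (suc a) + z) (trans (pos-* a (a ℕ.* 1)) (cong (λ z → + a * + z) (ℕ.*-identityʳ a))) ⟨
    + U r (suc a) + + (a ℕ.^ 2)
      ≡⟨ pos-+ (U r (suc a)) (a ℕ.^ 2) ⟨
    + U⁺ r (suc a)
      ∎
    where
    open ≡-Reasoning
    lemma : ∀ a → 1ℤ + (1ℤ + a) * (-[1+ 1 ] + (1ℤ + a) * (1ℤ + (1ℤ + a) * 0ℤ)) ≡ a * a
    lemma = solve-∀

  constant : ∀ {n} → ℤ → Vec ℤ (suc n)
  constant c = c ∷ Vec.replicate _ 0ℤ

  eval-constant : ∀ {n} c x → eval (toList (constant {n} c)) x ≡ c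
  eval-constant {n} c x rewrite eval-zeros n x = lemma c x
    where lemma : ∀ c x → c + x * 0ℤ ≡ c
          lemma = solve-∀

  record Modulus : Set where
    field
      {degree}     : ℕ
      coefficients : Vec ℤ (suc degree)
      nonNegative  : All (0ℤ ≤_) (translate (+ 2) (monic coefficients))
      2≤value[2]   : 2 ℕ.≤ ∣ eval (monic coefficients) (+ 2) ∣

  open Modulus public

  mkModulus : ∀ {d} (φ : Vec ℤ (suc d)) →
              {_ : True (all? (0ℤ ≤?_) (translate (+ 2) (monic φ)))} →
              {_ : True (2 ℕ.≤? ∣ eval (monic φ) (+ 2) ∣)} →
              Modulus
  mkModulus φ {nonNegative} {2≤value[2]} = record
    { coefficients = φ ; nonNegative = toWitness nonNegative ; 2≤value[2] = toWitness 2≤value[2] }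

  record BézoutCertificate (Φ Ψ : Modulus) : Set where
    field
      factor  : Poly
      primes  : List ℕ
      reduces : factor ⊗ monic (coefficients Φ) mod coefficients Ψ ≡ constant (+ product primes)

  module Evaluation (α : ℕ) (2≤α : 2 ℕ.≤ α) where

    ⟦_⟧ : Modulus → ℤ
    ⟦ Φ ⟧ = eval (monic (coefficients Φ)) (+ α)

    value : Modulus → ℕ
    value Φ = ∣ ⟦ Φ ⟧ ∣

    2≤value : ∀ Φ → 2 ℕ.≤ value Φ
    2≤value Φ = ℕ.≤-trans (2≤value[2] Φ) (eval-mono-from-2 (monic (coefficients Φ)) (nonNegative Φ) 2≤α)

    ⟦⟧∣-mod : ∀ Φ p {v} → p mod coefficients Φ ≡ v → ⟦ Φ ⟧ ∣ eval p (+ α) - eval (toList v) (+ α)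
    ⟦⟧∣-mod Φ p refl = mod-sound p (coefficients Φ) (+ α)

    coprime-to-primes : ∀ Φ {ps} → All Prime ps → All (λ p → ¬ + p ∣ ⟦ Φ ⟧) ps →
                        Coprime (value Φ) (product ps)
    coprime-to-primes Φ primes ∤ = coprime-product (All.zipWith coprime-to-prime (primes , ∤))
      where
      coprime-to-prime : ∀ {p} → Prime p × ¬ + p ∣ ⟦ Φ ⟧ → Coprime (value Φ) p
      coprime-to-prime (p-prime , p∤) = prime∤⇒coprime p-prime (λ p∣ → p∤ (∣ᵤ⇒∣ p∣))

    covering-class : ∀ j r {{_ : NonZero j}} (Φ : Modulus) (T : Poly) (ps : List ℕ) →
                     {_ : True (all? prime? ps)} →
                     replicate j 1ℤ mod coefficients Φ ≡ Vec.replicate _ 0ℤ →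
                     U⁺-poly r ⊗ T mod coefficients Φ ≡ constant (+ product ps) →
                     All (λ p → ¬ + p ∣ ⟦ Φ ⟧) ps →
                     CoveringClass α
    covering-class j r Φ T ps {primes} Φ∣U Φ∣U⁺T-D ∤ = record
      { period        = j
      ; residue       = r
      ; modulus       = value Φ
      ; 2≤modulus     = 2≤value Φ
      ; modulus∣U     = ∣⇒∣ᵤ (subst (⟦ Φ ⟧ ∣_) U-≡ (⟦⟧∣-mod Φ (replicate j 1ℤ) Φ∣U))
      ; kClass        = proj₁ inverse
      ; modulus∣kU⁺+1 = proj₂ inverse
      }
      where
      d : ℕ
      d = Modulus.degree Φ
      D : ℤ
      D = + product ps
      U-≡ : eval (replicate j 1ℤ) (+ α) - eval (toList (Vec.replicate (suc d) 0ℤ)) (+ α) ≡ + U j α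
      U-≡ rewrite eval-ones j α | eval-zeros (suc d) (+ α) = +-identityʳ (+ U j α)
      U⁺T-≡ : eval (U⁺-poly r ⊗ T) (+ α) - eval (toList (constant {d} D)) (+ α) ≡ + U⁺ r α * eval T (+ α) - D
      U⁺T-≡ rewrite eval-⊗ (U⁺-poly r) T (+ α) | eval-U⁺-poly r (ℕ.≤-trans (ℕ.s≤s ℕ.z≤n) 2≤α)
                  | eval-constant {d} D (+ α) = refl
      inverse : ∃ λ c → + value Φ ∣ c * + U⁺ r α + 1ℤ
      inverse = invertible-mod (+ U⁺ r α) (eval T (+ α)) (coprime-to-primes Φ (toWitness primes) ∤)
                  (∣-trans ∣m∣∣m (subst (⟦ Φ ⟧ ∣_) U⁺T-≡ (⟦⟧∣-mod Φ (U⁺-poly r ⊗ T) Φ∣U⁺T-D)))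

    coprime-values : ∀ {Φ Ψ} (cert : BézoutCertificate Φ Ψ) → let open BézoutCertificate cert in
                     {_ : True (all? prime? primes)} → All (λ p → ¬ + p ∣ ⟦ Ψ ⟧) primes →
                     Coprime (value Φ) (value Ψ)
    coprime-values {Φ} {Ψ} cert {primes-prime} ∤ {d} (d∣Φ , d∣Ψ) =
      coprime-to-primes Ψ (toWitness primes-prime) ∤ (d∣Ψ , ∣⇒∣ᵤ d∣D)
      where
      open BézoutCertificate cert
      D TΦ : ℤ
      D  = + product primes
      TΦ = eval factor (+ α) * ⟦ Φ ⟧
      TΦ-≡ : eval (factor ⊗ monic (coefficients Φ)) (+ α) - eval (toList (constant {Modulus.degree Ψ} D)) (+ α)
             ≡ TΦ - D
      TΦ-≡ rewrite eval-⊗ factor (monic (coefficients Φ)) (+ α) | eval-constant {Modulus.degree Ψ} D (+ α) = refl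
      Ψ∣TΦ-D : ⟦ Ψ ⟧ ∣ TΦ - D
      Ψ∣TΦ-D = subst (⟦ Ψ ⟧ ∣_) TΦ-≡ (⟦⟧∣-mod Ψ (factor ⊗ monic (coefficients Φ)) reduces)
      d∣D : + d ∣ D
      d∣D = subst (+ d ∣_) (lemma TΦ D)
        (∣m∣n⇒∣m-n (∣n⇒∣m*n (eval factor (+ α)) (∣ᵤ⇒∣ d∣Φ)) (∣-trans (∣ᵤ⇒∣ d∣Ψ) Ψ∣TΦ-D))
        where lemma : ∀ x d → x - (x - d) ≡ d
              lemma = solve-∀

module PowersOfFour where

  open Polynomials using (Poly; eval; ∤-cong; monic)
  open Congruences using (pos-^; ∣-^-cong)
  open Certificates using (coefficients; module Evaluation)
  open import Data.Fin.Base using (Fin; toℕ; fromℕ<)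
  import Data.Fin.Properties as Fin
  open import Data.Integer.Base using (ℤ; +_; 0ℤ; 1ℤ; _+_; _-_; _*_; _^_)
  open import Data.Integer.Divisibility.Signed using (_∣_; _∣?_; ∣n⇒∣m*n; ∣ᵤ⇒∣)
  open import Data.Integer.Properties using (pos-*; ^-zeroˡ; +-identityʳ)
  open import Data.Integer.Tactic.RingSolver using (solve-∀)
  open import Data.Nat.Base as ℕ using (ℕ; NonZero; _%_; _/_; _≤_)
  import Data.Nat.Divisibility as ℕ
  open import Data.Nat.DivMod using (m≡m%n+[m/n]*n; m%n<n)
  import Data.Nat.Properties as ℕ
  open import Relation.Nullary.Decidable using (True; toWitness; ¬?)
  open import Relation.Nullary.Negation using (¬_)
  open import Relation.Binary.PropositionalEquality
    using (_≡_; sym; trans; cong; cong₂; subst; module ≡-Reasoning)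

  module PowerOfFour (B t : ℕ) (2≤B : 2 ≤ B) (2∣B : 2 ℕ.∣ B) where

    α : ℕ
    α = B ℕ.* 4 ℕ.^ t

    open Evaluation α (ℕ.≤-trans 2≤B (ℕ.m≤m*n B (4 ℕ.^ t) {{ℕ.m^n≢0 4 t}})) public

    α≡B*4^[t%o] : ∀ {p} o .{{_ : NonZero o}} → + p ∣ + (4 ℕ.^ o) - 1ℤ →
                  + p ∣ + α - + (B ℕ.* 4 ℕ.^ (t % o))
    α≡B*4^[t%o] {p} o p∣4^o-1 = subst (+ p ∣_) (sym α-≡) (∣n⇒∣m*n (+ B * F) p∣X-1)
      where
      open ≡-Reasoning
      c q : ℕ
      c = t % o
      q = t / o
      F X : ℤ
      F = + (4 ℕ.^ c)
      X = (+ (4 ℕ.^ o)) ^ q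
      p∣X-1 : + p ∣ X - 1ℤ
      p∣X-1 = subst (λ z → + p ∣ X - z) (^-zeroˡ q) (∣-^-cong q p∣4^o-1)
      4^t≡ : 4 ℕ.^ t ≡ 4 ℕ.^ c ℕ.* (4 ℕ.^ o) ℕ.^ q
      4^t≡ = begin
        4 ℕ.^ t                      ≡⟨ cong (4 ℕ.^_) (m≡m%n+[m/n]*n t o) ⟩
        4 ℕ.^ (c ℕ.+ q ℕ.* o)        ≡⟨ ℕ.^-distribˡ-+-* 4 c (q ℕ.* o) ⟩
        4 ℕ.^ c ℕ.* 4 ℕ.^ (q ℕ.* o)  ≡⟨ cong (λ e → 4 ℕ.^ c ℕ.* 4 ℕ.^ e) (ℕ.*-comm q o) ⟩
        4 ℕ.^ c ℕ.* 4 ℕ.^ (o ℕ.* q)  ≡⟨ cong (4 ℕ.^ c ℕ.*_) (ℕ.^-*-assoc 4 o q) ⟨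
        4 ℕ.^ c ℕ.* (4 ℕ.^ o) ℕ.^ q  ∎
      α-≡ : + α - + (B ℕ.* 4 ℕ.^ c) ≡ + B * F * (X - 1ℤ)
      α-≡ = begin
        + α - + (B ℕ.* 4 ℕ.^ c)              ≡⟨ cong₂ (λ x y → + x - y) (cong (B ℕ.*_) 4^t≡) (pos-* B (4 ℕ.^ c)) ⟩
        + (B ℕ.* (4 ℕ.^ c ℕ.* (4 ℕ.^ o) ℕ.^ q)) - + B * F
          ≡⟨ cong (_- + B * F) (trans (pos-* B _) (cong (λ z → + B * z) +4^c*X≡)) ⟩
        + B * (F * X) - + B * F              ≡⟨ lemma (+ B) F X ⟩
        + B * F * (X - 1ℤ)                   ∎
        where
        +4^c*X≡ : + (4 ℕ.^ c ℕ.* (4 ℕ.^ o) ℕ.^ q) ≡ F * X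
        +4^c*X≡ = trans (pos-* (4 ℕ.^ c) _) (cong (λ z → F * z) (pos-^ (4 ℕ.^ o) q))
        lemma : ∀ b f x → b * (f * x) - b * f ≡ b * f * (x - 1ℤ)
        lemma = solve-∀

    ∤-by-residues : ∀ p o .{{_ : NonZero o}} Φ → let f = monic (coefficients Φ) in
                    {_ : True (+ p ∣? + (4 ℕ.^ o) - 1ℤ)} →
                    {_ : True (Fin.all? (λ (c : Fin o) → ¬? (+ p ∣? eval f (+ (B ℕ.* 4 ℕ.^ toℕ c)))))} →
                    ¬ + p ∣ ⟦ Φ ⟧
    ∤-by-residues p o Φ {p∣4^o-1} {residues} =
      ∤-cong f (α≡B*4^[t%o] o (toWitness p∣4^o-1))
        (subst (λ c → ¬ + p ∣ eval f (+ (B ℕ.* 4 ℕ.^ c))) c≡t%o p∤f[c])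
      where
      f : Poly
      f = monic (coefficients Φ)
      c≡t%o : toℕ (fromℕ< (m%n<n t o)) ≡ t % o
      c≡t%o = Fin.toℕ-fromℕ< (m%n<n t o)
      p∤f[c] : ¬ + p ∣ eval f (+ (B ℕ.* 4 ℕ.^ toℕ (fromℕ< (m%n<n t o))))
      p∤f[c] = toWitness residues (fromℕ< (m%n<n t o))

    2∤ : ∀ Φ {_ : True (¬? (+ 2 ∣? eval (monic (coefficients Φ)) 0ℤ))} → ¬ + 2 ∣ ⟦ Φ ⟧
    2∤ Φ {odd} = ∤-cong (monic (coefficients Φ)) 2∣α-0 (toWitness odd)
      where
      2∣α-0 : + 2 ∣ + α - 0ℤ
      2∣α-0 = subst (+ 2 ∣_) (sym (+-identityʳ (+ α))) (∣ᵤ⇒∣ (ℕ.∣m⇒∣m*n (4 ℕ.^ t) 2∣B))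

module CyclotomicCoverings where

  open Arithmetic using (U⁺)
  open Certificates using (Modulus; mkModulus; BézoutCertificate)
  open CoveringSystems using (CoveringClass; modulus; composite-from-covering; covered-by-residues)
  open PowersOfFour using (module PowerOfFour)
  open import Agda.Builtin.FromNat using (Number; fromNat)
  open import Agda.Builtin.FromNeg using (Negative; fromNeg)
  open import Data.Integer.Base using (ℤ)
  import Data.Integer.Literals as ℤ
  open import Data.List.Base using (List; []; _∷_)
  open import Data.List.Relation.Unary.All using ([]; _∷_)
  open import Data.List.Relation.Unary.AllPairs using (AllPairs; []; _∷_)
  open import Data.Nat.Base as ℕ using (ℕ; _≤_; _<_; z≤n; s≤s)
  open import Data.Nat.Coprimality using (Coprime)
  import Data.Nat.Divisibility as ℕ
  import Data.Nat.Literals as ℕ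
  open import Data.Nat.Primality using (Composite)
  open import Data.Product.Base using (∃; _×_)
  open import Data.Unit.Base using (tt)
  open import Data.Vec.Base using (_∷_; [])
  open import Function.Base using (_on_)
  open import Relation.Binary.PropositionalEquality using (refl)

  instance
    ℕ-number : Number ℕ
    ℕ-number = ℕ.number
    ℤ-number : Number ℤ
    ℤ-number = ℤ.number
    ℤ-negative : Negative ℤ
    ℤ-negative = ℤ.negative

  -- Cyclotomic polynomials, each given by its coefficients below the leading 1, constant first.
  Φ₂ : Modulus
  Φ₂ = mkModulus (1 ∷ [])

  Φ₃ : Modulus
  Φ₃ = mkModulus (1 ∷ 1 ∷ [])

  Φ₄ : Modulus
  Φ₄ = mkModulus (1 ∷ 0 ∷ [])

  Φ₆ : Modulus
  Φ₆ = mkModulus (1 ∷ -1 ∷ [])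

  Φ₈ : Modulus
  Φ₈ = mkModulus (1 ∷ 0 ∷ 0 ∷ 0 ∷ [])

  Φ₁₂ : Modulus
  Φ₁₂ = mkModulus (1 ∷ 0 ∷ -1 ∷ 0 ∷ [])

  Φ₂₄ : Modulus
  Φ₂₄ = mkModulus (1 ∷ 0 ∷ 0 ∷ 0 ∷ -1 ∷ 0 ∷ 0 ∷ 0 ∷ [])

  -- Each factor is D times the inverse of Φ modulo Ψ, found by the extended Euclidean algorithm
  -- over ℚ, with D = product primes clearing its denominators.
  Φ₂⊥Φ₃ : BézoutCertificate Φ₂ Φ₃
  Φ₂⊥Φ₃ = record { factor = 0 ∷ -1 ∷ [] ; primes = [] ; reduces = refl }

  Φ₂⊥Φ₄ : BézoutCertificate Φ₂ Φ₄
  Φ₂⊥Φ₄ = record { factor = 1 ∷ -1 ∷ [] ; primes = 2 ∷ [] ; reduces = refl }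

  Φ₂⊥Φ₆ : BézoutCertificate Φ₂ Φ₆
  Φ₂⊥Φ₆ = record { factor = 2 ∷ -1 ∷ [] ; primes = 3 ∷ [] ; reduces = refl }

  Φ₂⊥Φ₈ : BézoutCertificate Φ₂ Φ₈
  Φ₂⊥Φ₈ = record { factor = 1 ∷ -1 ∷ 1 ∷ -1 ∷ [] ; primes = 2 ∷ [] ; reduces = refl }

  Φ₂⊥Φ₁₂ : BézoutCertificate Φ₂ Φ₁₂
  Φ₂⊥Φ₁₂ = record { factor = 0 ∷ 0 ∷ 1 ∷ -1 ∷ [] ; primes = [] ; reduces = refl }

  Φ₂⊥Φ₂₄ : BézoutCertificate Φ₂ Φ₂₄
  Φ₂⊥Φ₂₄ = record { factor = 0 ∷ 0 ∷ 0 ∷ 0 ∷ 1 ∷ -1 ∷ 1 ∷ -1 ∷ [] ; primes = [] ; reduces = refl }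

  Φ₃⊥Φ₄ : BézoutCertificate Φ₃ Φ₄
  Φ₃⊥Φ₄ = record { factor = 0 ∷ -1 ∷ [] ; primes = [] ; reduces = refl }

  Φ₃⊥Φ₈ : BézoutCertificate Φ₃ Φ₈
  Φ₃⊥Φ₈ = record { factor = 1 ∷ 0 ∷ -1 ∷ 1 ∷ [] ; primes = [] ; reduces = refl }

  Φ₃⊥Φ₁₂ : BézoutCertificate Φ₃ Φ₁₂
  Φ₃⊥Φ₁₂ = record { factor = 2 ∷ -1 ∷ -1 ∷ 1 ∷ [] ; primes = 2 ∷ [] ; reduces = refl }

  Φ₃⊥Φ₂₄ : BézoutCertificate Φ₃ Φ₂₄
  Φ₃⊥Φ₂₄ = record { factor = 1 ∷ -2 ∷ 1 ∷ 1 ∷ -1 ∷ 1 ∷ 0 ∷ -1 ∷ [] ; primes = 2 ∷ [] ; reduces = refl }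

  Φ₄⊥Φ₆ : BézoutCertificate Φ₄ Φ₆
  Φ₄⊥Φ₆ = record { factor = 1 ∷ -1 ∷ [] ; primes = [] ; reduces = refl }

  Φ₄⊥Φ₈ : BézoutCertificate Φ₄ Φ₈
  Φ₄⊥Φ₈ = record { factor = 1 ∷ 0 ∷ -1 ∷ [] ; primes = 2 ∷ [] ; reduces = refl }

  Φ₄⊥Φ₁₂ : BézoutCertificate Φ₄ Φ₁₂
  Φ₄⊥Φ₁₂ = record { factor = 2 ∷ 0 ∷ -1 ∷ [] ; primes = 3 ∷ [] ; reduces = refl }

  Φ₄⊥Φ₂₄ : BézoutCertificate Φ₄ Φ₂₄
  Φ₄⊥Φ₂₄ = record { factor = 0 ∷ 0 ∷ 0 ∷ 0 ∷ 1 ∷ 0 ∷ -1 ∷ [] ; primes = [] ; reduces = refl }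

  Φ₆⊥Φ₈ : BézoutCertificate Φ₆ Φ₈
  Φ₆⊥Φ₈ = record { factor = 1 ∷ 0 ∷ -1 ∷ -1 ∷ [] ; primes = [] ; reduces = refl }

  Φ₆⊥Φ₁₂ : BézoutCertificate Φ₆ Φ₁₂
  Φ₆⊥Φ₁₂ = record { factor = 2 ∷ 1 ∷ -1 ∷ -1 ∷ [] ; primes = 2 ∷ [] ; reduces = refl }

  Φ₆⊥Φ₂₄ : BézoutCertificate Φ₆ Φ₂₄
  Φ₆⊥Φ₂₄ = record { factor = 1 ∷ 2 ∷ 1 ∷ -1 ∷ -1 ∷ -1 ∷ 0 ∷ 1 ∷ [] ; primes = 2 ∷ [] ; reduces = refl }

  Φ₈⊥Φ₁₂ : BézoutCertificate Φ₈ Φ₁₂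
  Φ₈⊥Φ₁₂ = record { factor = 1 ∷ 0 ∷ -1 ∷ [] ; primes = [] ; reduces = refl }

  Φ₈⊥Φ₂₄ : BézoutCertificate Φ₈ Φ₂₄
  Φ₈⊥Φ₂₄ = record { factor = 2 ∷ 0 ∷ 0 ∷ 0 ∷ -1 ∷ [] ; primes = 3 ∷ [] ; reduces = refl }

  Φ₁₂⊥Φ₂₄ : BézoutCertificate Φ₁₂ Φ₂₄
  Φ₁₂⊥Φ₂₄ = record { factor = 2 ∷ 0 ∷ 1 ∷ 0 ∷ -1 ∷ 0 ∷ -1 ∷ [] ; primes = 2 ∷ [] ; reduces = refl }

  -- The polynomial argument of each covering-class is D times the inverse of U⁺-poly r modulo
  -- Φ_d, likewise found over ℚ, with D the product of the listed primes.
  module FourTimesPowerOfFour (t : ℕ) where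

    open PowerOfFour 4 t (s≤s (s≤s z≤n)) (ℕ.divides 2 refl)

    C₀ : CoveringClass α
    C₀ = covering-class 2 0 Φ₂ (1 ∷ []) (2 ∷ 2 ∷ []) refl refl (2∤ Φ₂ ∷ 2∤ Φ₂ ∷ [])

    C₁ : CoveringClass α
    C₁ = covering-class 4 1 Φ₄ (1 ∷ 2 ∷ []) (5 ∷ []) refl refl (∤-by-residues 5 2 Φ₄ ∷ [])

    C₂ : CoveringClass α
    C₂ = covering-class 6 1 Φ₆ (0 ∷ 1 ∷ []) [] refl refl []

    C₃ : CoveringClass α
    C₃ = covering-class 8 3 Φ₈ (2 ∷ 0 ∷ -2 ∷ -1 ∷ []) (7 ∷ []) refl refl (∤-by-residues 7 3 Φ₈ ∷ [])

    C₄ : CoveringClass α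
    C₄ = covering-class 12 3 Φ₁₂ (4 ∷ 1 ∷ -2 ∷ -1 ∷ []) (11 ∷ []) refl refl
      (∤-by-residues 11 5 Φ₁₂ ∷ [])

    C₅ : CoveringClass α
    C₅ = covering-class 24 23 Φ₂₄ (-2 ∷ 1 ∷ 0 ∷ -4 ∷ -1 ∷ -3 ∷ 0 ∷ 5 ∷ []) (7 ∷ []) refl refl
      (∤-by-residues 7 3 Φ₂₄ ∷ [])

    classes : List (CoveringClass α)
    classes = C₀ ∷ C₁ ∷ C₂ ∷ C₃ ∷ C₄ ∷ C₅ ∷ []

    pairwise : AllPairs (Coprime on modulus) classes
    pairwise =
      ( coprime-values Φ₂⊥Φ₄ (2∤ Φ₄ ∷ [])
        ∷ coprime-values Φ₂⊥Φ₆ (∤-by-residues 3 1 Φ₆ ∷ [])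
        ∷ coprime-values Φ₂⊥Φ₈ (2∤ Φ₈ ∷ [])
        ∷ coprime-values Φ₂⊥Φ₁₂ []
        ∷ coprime-values Φ₂⊥Φ₂₄ []
        ∷ [] )
      ∷ ( coprime-values Φ₄⊥Φ₆ []
        ∷ coprime-values Φ₄⊥Φ₈ (2∤ Φ₈ ∷ [])
        ∷ coprime-values Φ₄⊥Φ₁₂ (∤-by-residues 3 1 Φ₁₂ ∷ [])
        ∷ coprime-values Φ₄⊥Φ₂₄ []
        ∷ [] )
      ∷ ( coprime-values Φ₆⊥Φ₈ []
        ∷ coprime-values Φ₆⊥Φ₁₂ (2∤ Φ₁₂ ∷ [])
        ∷ coprime-values Φ₆⊥Φ₂₄ (2∤ Φ₂₄ ∷ [])
        ∷ [] )
      ∷ ( coprime-values Φ₈⊥Φ₁₂ []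
        ∷ coprime-values Φ₈⊥Φ₂₄ (∤-by-residues 3 1 Φ₂₄ ∷ [])
        ∷ [] )
      ∷ ( coprime-values Φ₁₂⊥Φ₂₄ (2∤ Φ₂₄ ∷ [])
        ∷ [] )
      ∷ []
      ∷ []

    composite-for-all-n : ∀ m → ∃ λ k → m < k × (∀ n → 1 ≤ n → Composite (k ℕ.* U⁺ n α ℕ.+ 1))
    composite-for-all-n = composite-from-covering classes pairwise (covered-by-residues 24 classes)

  module TwiceAPowerOfFour (t : ℕ) where

    open PowerOfFour 2 t (s≤s (s≤s z≤n)) ℕ.∣-refl

    C₀ : CoveringClass α
    C₀ = covering-class 2 1 Φ₂ (1 ∷ []) (5 ∷ []) refl refl (∤-by-residues 5 2 Φ₂ ∷ [])

    C₁ : CoveringClass α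
    C₁ = covering-class 3 0 Φ₃ (1 ∷ 1 ∷ []) (3 ∷ []) refl refl (∤-by-residues 3 1 Φ₃ ∷ [])

    C₂ : CoveringClass α
    C₂ = covering-class 4 0 Φ₄ (0 ∷ 1 ∷ []) (2 ∷ []) refl refl (2∤ Φ₄ ∷ [])

    C₃ : CoveringClass α
    C₃ = covering-class 8 6 Φ₈ (-1 ∷ -3 ∷ -3 ∷ 1 ∷ []) (2 ∷ 5 ∷ []) refl refl
      (2∤ Φ₈ ∷ ∤-by-residues 5 2 Φ₈ ∷ [])

    C₄ : CoveringClass α
    C₄ = covering-class 12 10 Φ₁₂ (2 ∷ -25 ∷ -18 ∷ 6 ∷ []) (73 ∷ []) refl refl
      (∤-by-residues 73 9 Φ₁₂ ∷ [])

    C₅ : CoveringClass α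
    C₅ = covering-class 24 2 Φ₂₄ (8 ∷ 4 ∷ -2 ∷ -3 ∷ -1 ∷ 1 ∷ 1 ∷ []) (3 ∷ 5 ∷ []) refl refl
      (∤-by-residues 3 1 Φ₂₄ ∷ ∤-by-residues 5 2 Φ₂₄ ∷ [])

    classes : List (CoveringClass α)
    classes = C₀ ∷ C₁ ∷ C₂ ∷ C₃ ∷ C₄ ∷ C₅ ∷ []

    pairwise : AllPairs (Coprime on modulus) classes
    pairwise =
      ( coprime-values Φ₂⊥Φ₃ []
        ∷ coprime-values Φ₂⊥Φ₄ (2∤ Φ₄ ∷ [])
        ∷ coprime-values Φ₂⊥Φ₈ (2∤ Φ₈ ∷ [])
        ∷ coprime-values Φ₂⊥Φ₁₂ []
        ∷ coprime-values Φ₂⊥Φ₂₄ []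
        ∷ [] )
      ∷ ( coprime-values Φ₃⊥Φ₄ []
        ∷ coprime-values Φ₃⊥Φ₈ []
        ∷ coprime-values Φ₃⊥Φ₁₂ (2∤ Φ₁₂ ∷ [])
        ∷ coprime-values Φ₃⊥Φ₂₄ (2∤ Φ₂₄ ∷ [])
        ∷ [] )
      ∷ ( coprime-values Φ₄⊥Φ₈ (2∤ Φ₈ ∷ [])
        ∷ coprime-values Φ₄⊥Φ₁₂ (∤-by-residues 3 1 Φ₁₂ ∷ [])
        ∷ coprime-values Φ₄⊥Φ₂₄ []
        ∷ [] )
      ∷ ( coprime-values Φ₈⊥Φ₁₂ []
        ∷ coprime-values Φ₈⊥Φ₂₄ (∤-by-residues 3 1 Φ₂₄ ∷ [])
        ∷ [] )
      ∷ ( coprime-values Φ₁₂⊥Φ₂₄ (2∤ Φ₂₄ ∷ [])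
        ∷ [] )
      ∷ []
      ∷ []

    composite-for-all-n : ∀ m → ∃ λ k → m < k × (∀ n → 1 ≤ n → Composite (k ℕ.* U⁺ n α ℕ.+ 1))
    composite-for-all-n = composite-from-covering classes pairwise (covered-by-residues 24 classes)

open OddDivisor using (odd-divisor-case)
open CyclotomicCoverings using (module FourTimesPowerOfFour; module TwiceAPowerOfFour)
open Arithmetic using (shape; oddDivisor; powerOfFour; twicePowerOfFour)
open import Data.Nat using (ℕ; zero; suc; _+_; _*_; _∸_; _^_; _≤_; _<_; z≤n; s≤s)
open import Data.Nat.Properties using (≤-trans)
open import Data.Nat.Primality using (Composite)
open import Data.Product using (∃; _×_)
open import Relation.Nullary.Negation using (contradiction)

theorem2p6 : (α : ℕ) → 2 ≤ α →
    (m : ℕ) → ∃ λ k → m < k ×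
    ((n : ℕ) → 1 ≤ n → Composite (k * (U n α + (α ∸ 1) ^ 2) + 1))
theorem2p6 α 2≤α with shape α (≤-trans (s≤s z≤n) 2≤α)
... | oddDivisor h q∣α    = odd-divisor-case h q∣α (≤-trans (s≤s z≤n) 2≤α)
... | powerOfFour zero    = contradiction 2≤α λ { (s≤s ()) }
... | powerOfFour (suc t) = FourTimesPowerOfFour.composite-for-all-n t
... | twicePowerOfFour t  = TwiceAPowerOfFour.composite-for-all-n t
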